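{- Let $\mathbb{A}=(A,(\mathrm{Con}_i)_{i\in A},(\vDash_i)_{i\in A})$ be a continuous information frame and $\mathbf t\notin A$. Set $\overline A=A\cup\{\mathbf t\}$; for $a\in A$ let $\overline{\mathrm{Con}}_a=\mathrm{Con}_a\cup\{X\cup\{\mathbf t\}:X\in\mathrm{Con}_a\}$, and let $\overline{\mathrm{Con}}_{\mathbf t}=\{\{\mathbf t\},\emptyset\}$; for $a\in\overline A$, $X\in\overline{\mathrm{Con}}_a$ and $c\in\overline A$ let $X\mathrel{\overline\vDash}_a c$ iff either ($a\neq\mathbf t$, $c\neq\mathbf t$ and $X\setminus\{\mathbf t\}\vDash_a c$) or ($a=\mathbf t$ or $c=\mathbf t$, and $c=\mathbf t$). Then $\mathcal W(\mathbb A)=(\overline A,(\overline{\mathrm{Con}}_i)_{i\in\overline A},(\mathrel{\overline\vDash}_i)_{i\in\overline A})$ is a continuous information frame with truth element $\mathbf t$.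
   Context: A continuous information frame is a triple $\mathbb{A}=(A,(\mathrm{Con}_i)_{i\in A},(\vDash_i)_{i\in A})$ where $A$ is a set, each $\mathrm{Con}_i$ is a set of finite subsets of $A$, and $\vDash_i\subseteq\mathrm{Con}_i\times A$; write $iRj$ iff $\{i\}\in\mathrm{Con}_j$, and for finite $Y$, $X\vDash_i Y$ iff $X\vDash_i b$ for all $b\in Y$. Required, for all $i,j,a\in A$ and finite $X,Y\subseteq A$: (i) $\{i\}\in\mathrm{Con}_i$; (ii) if $Y\subseteq X\in\mathrm{Con}_i$ then $Y\in\mathrm{Con}_i$; (iii) if $X\in\mathrm{Con}_i$ and $X\vDash_i Y$ then $Y\in\mathrm{Con}_i$; (iv) if $X,Y\in\mathrm{Con}_i$, $X\subseteq Y$ and $X\vDash_i a$ then $Y\vDash_i a$; (v) if $X\in\mathrm{Con}_i$, $X\vDash_i Y$ and $Y\vDash_i a$ then $X\vDash_i a$; (vi) if $iRj$ then $\mathrm{Con}_i\subseteq\mathrm{Con}_j$; (vii) if $iRj$, $X\in\mathrm{Con}_i$ and $X\vDash_i a$ then $X\vDash_j a$; (viii) if $X\vDash_i Y$ then there exist $e\in A$ and $Z\in\mathrm{Con}_e$ with $X\vDash_i \{e\}\cup Z$ and $Z\vDash_e Y$. A token $\mathbf t$ is a truth element if $\emptyset\vDash_i\mathbf t$ for all tokens $i$. -}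

module Defs where

open import Level using (Level; _⊔_) renaming (suc to lsuc)
open import Data.List using (List; []; _∷_; [_]; map; mapMaybe)
open import Data.List.Membership.Propositional using (_∈_)
open import Data.List.Relation.Binary.Subset.Propositional using (_⊆_)
open import Data.List.Relation.Unary.All using (All)
open import Data.Maybe using (Maybe; just; nothing)
open import Data.Product using (Σ; _×_)
open import Data.Sum using (_⊎_)
open import Data.Empty.Polymorphic using (⊥)
open import Function using (id)

-- Finite subsets of a type are represented by lists; X ⊆ Y is
-- membership inclusion, so lists with the same elements denote the same set.

_≈ₛ_ : ∀ {ℓ} {A : Set ℓ} → List A → List A → Set ℓ
X ≈ₛ Y = (X ⊆ Y) × (Y ⊆ X)

module Frame {ℓ : Level} {A : Set ℓ}
             (Con : A → List A → Set ℓ)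
             (Ent : A → List A → A → Set ℓ) where

  R : A → A → Set ℓ
  R i j = Con j [ i ]

  EntL : A → List A → List A → Set ℓ
  EntL i X Y = Con i X × All (Ent i X) Y

  record IsCIF : Set ℓ where
    field
      ent-con : ∀ {i X a} → Ent i X a → Con i X
      ax1 : ∀ i → Con i [ i ]
      ax2 : ∀ {i X Y} → Y ⊆ X → Con i X → Con i Y
      ax3 : ∀ {i X Y} → Con i X → EntL i X Y → Con i Y
      ax4 : ∀ {i X Y a} → Con i X → Con i Y → X ⊆ Y → Ent i X a → Ent i Y a
      ax5 : ∀ {i X Y a} → Con i X → EntL i X Y → Ent i Y a → Ent i X a
      ax6 : ∀ {i j X} → R i j → Con i X → Con j X
      ax7 : ∀ {i j X a} → R i j → Con i X → Ent i X a → Ent j X a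
      ax8 : ∀ {i X Y} → EntL i X Y →
            Σ A λ e → Σ (List A) λ Z → Con e Z × EntL i X (e ∷ Z) × EntL e Z Y

  IsTruth : A → Set ℓ
  IsTruth t = ∀ i → Ent i [] t

-- The construction W(A): carrier Maybe A, with t = nothing the new token.
module W {ℓ : Level} {A : Set ℓ}
         (Con : A → List A → Set ℓ)
         (Ent : A → List A → A → Set ℓ) where

  t : Maybe A
  t = nothing

  -- X \ {t}, viewed as a finite subset of A
  strip : List (Maybe A) → List A
  strip = mapMaybe id

  ConW : Maybe A → List (Maybe A) → Set ℓ
  ConW (just a) X = Σ (List A) λ X′ → Con a X′ ×
                      ((X ≈ₛ map just X′) ⊎ (X ≈ₛ (t ∷ map just X′)))
  ConW nothing X = (X ≈ₛ [ t ]) ⊎ (X ≈ₛ [])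

  EntW : Maybe A → List (Maybe A) → Maybe A → Set ℓ
  EntW (just a) X (just c) = ConW (just a) X × Ent a (strip X) c
  EntW nothing  X (just c) = ⊥
  EntW a        X nothing  = ConW a X

{-# OPTIONS --safe #-}
module Submission where

-- A finite X ⊆ A ∪ {t} is consistent at a ∈ A exactly when X \ {t} ∈ Con_a (Con_a being
-- closed under subsets), and X ⊨‾_a c means X \ {t} ⊨_a c for c ∈ A while t is entailed
-- by every consistent set.  Hence each axiom at a token of A is the same axiom of 𝔸
-- applied to the stripped sets, and at t, where only ∅ and {t} are consistent and only t
-- is entailed, the axioms are immediate.  Of the mixed cases of (vi)/(vii), {a} ∈ Con‾_t
-- is impossible, and {t} ∈ Con‾_b only transfers sets stripping to ∅ ∈ Con_b.

open import Defs
open import Level using (Level)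
open import Data.Empty using (⊥-elim)
open import Data.List using (List; []; _∷_; [_]; map; mapMaybe)
open import Data.List.Properties using (mapMaybe-map; mapMaybe-just)
open import Data.List.Membership.Propositional using (_∈_)
open import Data.List.Membership.Propositional.Properties using (∈-map⁺; ∈-map⁻)
open import Data.List.Relation.Binary.Subset.Propositional using (_⊆_)
open import Data.List.Relation.Binary.Subset.Propositional.Properties using (⊆-refl)
open import Data.List.Relation.Unary.All as All using (All; []; _∷_)
import Data.List.Relation.Unary.All.Properties as All
open import Data.List.Relation.Unary.Any using (here; there; any?)
open import Data.Maybe using (Maybe; just; nothing)
import Data.Maybe.Relation.Unary.All as Maybe
open import Data.Product using (Σ; _×_; _,_)
open import Data.Sum using (_⊎_; inj₁; inj₂)
open import Function using (id; _∘′_)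
open import Relation.Binary.PropositionalEquality using (_≡_; refl; sym; trans; subst)
open import Relation.Nullary using (Dec; yes; no; ¬_)

module _ {ℓ : Level} {A : Set ℓ} where

  ∈-mapMaybe-id⁺ : ∀ {x : A} (xs : List (Maybe A)) → just x ∈ xs → x ∈ mapMaybe id xs
  ∈-mapMaybe-id⁺ (just y  ∷ xs) (here refl) = here refl
  ∈-mapMaybe-id⁺ (just y  ∷ xs) (there p)   = there (∈-mapMaybe-id⁺ xs p)
  ∈-mapMaybe-id⁺ (nothing ∷ xs) (there p)   = ∈-mapMaybe-id⁺ xs p

  ∈-mapMaybe-id⁻ : ∀ {x : A} (xs : List (Maybe A)) → x ∈ mapMaybe id xs → just x ∈ xs
  ∈-mapMaybe-id⁻ (just y  ∷ xs) (here refl) = here refl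
  ∈-mapMaybe-id⁻ (just y  ∷ xs) (there p)   = there (∈-mapMaybe-id⁻ xs p)
  ∈-mapMaybe-id⁻ (nothing ∷ xs) p           = there (∈-mapMaybe-id⁻ xs p)

  mapMaybe-id-mono : ∀ {xs ys : List (Maybe A)} → xs ⊆ ys → mapMaybe id xs ⊆ mapMaybe id ys
  mapMaybe-id-mono {xs} {ys} xs⊆ys p = ∈-mapMaybe-id⁺ ys (xs⊆ys (∈-mapMaybe-id⁻ xs p))

  mapMaybe-id-map-just : (xs : List A) → mapMaybe id (map just xs) ≡ xs
  mapMaybe-id-map-just xs = trans (mapMaybe-map id just xs) (mapMaybe-just xs)

  mapMaybe-id-⊆ : ∀ {xs : List (Maybe A)} {ys : List A} →
                  xs ⊆ nothing ∷ map just ys → mapMaybe id xs ⊆ ys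
  mapMaybe-id-⊆ {xs} {ys} xs⊆ =
    subst (mapMaybe id xs ⊆_) (mapMaybe-id-map-just ys) (mapMaybe-id-mono xs⊆)

  ⊆-nothing∷map-just-mapMaybe-id : ∀ {xs : List (Maybe A)} →
                                   xs ⊆ nothing ∷ map just (mapMaybe id xs)
  ⊆-nothing∷map-just-mapMaybe-id {x = nothing} p = here refl
  ⊆-nothing∷map-just-mapMaybe-id {xs} {just x} p = there (∈-map⁺ just (∈-mapMaybe-id⁺ xs p))

  map-just-mapMaybe-id-⊆ : ∀ {xs : List (Maybe A)} → map just (mapMaybe id xs) ⊆ xs
  map-just-mapMaybe-id-⊆ {xs} p with ∈-map⁻ just p
  ... | x , x∈ , refl = ∈-mapMaybe-id⁻ xs x∈

  nothing∈? : (xs : List (Maybe A)) → Dec (nothing ∈ xs)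
  nothing∈? = any? λ { nothing → yes refl ; (just _) → no λ () }

  ≈ₛ-map-just-mapMaybe-id : (xs : List (Maybe A)) →
                            (xs ≈ₛ map just (mapMaybe id xs))
                            ⊎ (xs ≈ₛ (nothing ∷ map just (mapMaybe id xs)))
  ≈ₛ-map-just-mapMaybe-id xs with nothing∈? xs
  ... | yes nothing∈xs = inj₂ (⊆-nothing∷map-just-mapMaybe-id , ⊇)
    where
    ⊇ : nothing ∷ map just (mapMaybe id xs) ⊆ xs
    ⊇ (here refl) = nothing∈xs
    ⊇ (there p)   = map-just-mapMaybe-id-⊆ p
  ... | no nothing∉xs = inj₁ (⊆ , map-just-mapMaybe-id-⊆)
    where
    ⊆ : xs ⊆ map just (mapMaybe id xs)
    ⊆ p with ⊆-nothing∷map-just-mapMaybe-id p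
    ... | here refl = ⊥-elim (nothing∉xs p)
    ... | there q   = q

  All-mapMaybe-id⁺ : ∀ {p} {P : A → Set p} {xs : List (Maybe A)} →
                     All (Maybe.All P) xs → All P (mapMaybe id xs)
  All-mapMaybe-id⁺ = All.mapMaybe⁺ ∘′ All.map⁺

  All-mapMaybe-id⁻ : ∀ {p} {P : A → Set p} (xs : List (Maybe A)) →
                     All P (mapMaybe id xs) → All (Maybe.All P) xs
  All-mapMaybe-id⁻ []             []       = []
  All-mapMaybe-id⁻ (nothing ∷ xs) ps       = Maybe.nothing ∷ All-mapMaybe-id⁻ xs ps
  All-mapMaybe-id⁻ (just x  ∷ xs) (p ∷ ps) = Maybe.just p ∷ All-mapMaybe-id⁻ xs ps

module _ {ℓ : Level} {A : Set ℓ}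
         (Con : A → List A → Set ℓ) (Ent : A → List A → A → Set ℓ) where

  open W Con Ent
  open Frame ConW EntW

  ConW-just⁺ : ∀ {a X} → Con a (strip X) → ConW (just a) X
  ConW-just⁺ {X = X} c = strip X , c , ≈ₛ-map-just-mapMaybe-id X

  ConW-map-just : ∀ {a X} → Con a X → ConW (just a) (map just X)
  ConW-map-just {X = X} c = X , c , inj₁ (⊆-refl , ⊆-refl)

  ConW-t⁺ : ∀ {X} → X ⊆ [ t ] → ConW t X
  ConW-t⁺ {[]}    _   = inj₂ ((λ ()) , (λ ()))
  ConW-t⁺ {x ∷ X} X⊆t = inj₁ (X⊆t , ⊇)
    where
    ⊇ : [ t ] ⊆ x ∷ X
    ⊇ (here refl) with X⊆t (here refl)
    ... | here refl = here refl

  ConW-t⁻ : ∀ {X} → ConW t X → X ⊆ [ t ]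
  ConW-t⁻ (inj₁ (X⊆t , _)) = X⊆t
  ConW-t⁻ (inj₂ (X⊆[] , _)) p with X⊆[] p
  ... | ()

  ¬R-just-t : ∀ {a} → ¬ R (just a) t
  ¬R-just-t r with ConW-t⁻ r (here refl)
  ... | here ()

  EntW⇒ConW : ∀ {i X c} → EntW i X c → ConW i X
  EntW⇒ConW {just a}  {c = just c}  (cX , _) = cX
  EntW⇒ConW {just a}  {c = nothing} cX       = cX
  EntW⇒ConW {nothing} {c = nothing} cX       = cX

  EntW-just⁺ : ∀ {a X c} → ConW (just a) X → Maybe.All (Ent a (strip X)) c → EntW (just a) X c
  EntW-just⁺ cX (Maybe.just e) = cX , e
  EntW-just⁺ cX Maybe.nothing  = cX

  EntW-just⁻ : ∀ {a X c} → EntW (just a) X c → Maybe.All (Ent a (strip X)) c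
  EntW-just⁻ {c = just c}  (_ , e) = Maybe.just e
  EntW-just⁻ {c = nothing} _       = Maybe.nothing

  EntW-t⁻ : ∀ {X c} → EntW t X c → c ≡ t
  EntW-t⁻ {c = nothing} _ = refl

  ConW⇒EntW-t : ∀ {i X} → ConW i X → EntW i X t
  ConW⇒EntW-t {just a}  cX = cX
  ConW⇒EntW-t {nothing} cX = cX

  EntW-t⇒EntW : ∀ {i X Y c} → ConW i Y → EntW t X c → EntW i Y c
  EntW-t⇒EntW {i} {Y = Y} cY e = subst (EntW i Y) (sym (EntW-t⁻ e)) (ConW⇒EntW-t cY)

  EntL-just⁺ : ∀ {a X Y} → ConW (just a) X → All (Ent a (strip X)) (strip Y) → EntL (just a) X Y
  EntL-just⁺ {Y = Y} cX XY = cX , All.map (EntW-just⁺ cX) (All-mapMaybe-id⁻ Y XY)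

  EntL-just⁻ : ∀ {a X Y} → EntL (just a) X Y → All (Ent a (strip X)) (strip Y)
  EntL-just⁻ (_ , XY) = All-mapMaybe-id⁺ (All.map EntW-just⁻ XY)

  EntL-t⁻ : ∀ {X Y} → EntL t X Y → Y ⊆ [ t ]
  EntL-t⁻ (_ , XY) p = here (EntW-t⁻ (All.lookup XY p))

  module _ (isCIF : Frame.IsCIF Con Ent) where

    open Frame.IsCIF isCIF

    Con-[] : ∀ a → Con a []
    Con-[] a = ax2 (λ ()) (ax1 a)

    ConW-just⁻ : ∀ {a X} → ConW (just a) X → Con a (strip X)
    ConW-just⁻ (X′ , cX′ , inj₁ (X⊆X′ , _)) = ax2 (mapMaybe-id-⊆ (there ∘′ X⊆X′)) cX′
    ConW-just⁻ (X′ , cX′ , inj₂ (X⊆tX′ , _)) = ax2 (mapMaybe-id-⊆ X⊆tX′) cX′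

    ConW-refl : ∀ i → ConW i [ i ]
    ConW-refl (just a) = ConW-just⁺ (ax1 a)
    ConW-refl nothing  = ConW-t⁺ ⊆-refl

    ConW-⊆ : ∀ {i X Y} → Y ⊆ X → ConW i X → ConW i Y
    ConW-⊆ {just a}  Y⊆X cX = ConW-just⁺ (ax2 (mapMaybe-id-mono Y⊆X) (ConW-just⁻ cX))
    ConW-⊆ {nothing} Y⊆X cX = ConW-t⁺ (ConW-t⁻ cX ∘′ Y⊆X)

    ConW-EntL : ∀ {i X Y} → ConW i X → EntL i X Y → ConW i Y
    ConW-EntL {just a}  cX XY =
      ConW-just⁺ (ax3 (ConW-just⁻ cX) (ConW-just⁻ cX , EntL-just⁻ XY))
    ConW-EntL {nothing} cX XY = ConW-t⁺ (EntL-t⁻ XY)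

    EntW-weaken : ∀ {i X Y c} → ConW i X → ConW i Y → X ⊆ Y → EntW i X c → EntW i Y c
    EntW-weaken {just a}  {c = c} cX cY X⊆Y e =
      EntW-just⁺ {c = c} cY
        (Maybe.map (ax4 (ConW-just⁻ cX) (ConW-just⁻ cY) (mapMaybe-id-mono X⊆Y))
                   (EntW-just⁻ {c = c} e))
    EntW-weaken {nothing} {c = c} _ cY _ e = EntW-t⇒EntW {c = c} cY e

    EntW-cut : ∀ {i X Y c} → ConW i X → EntL i X Y → EntW i Y c → EntW i X c
    EntW-cut {just a}  {c = c} cX XY e =
      EntW-just⁺ {c = c} cX
        (Maybe.map (ax5 (ConW-just⁻ cX) (ConW-just⁻ cX , EntL-just⁻ XY))
                   (EntW-just⁻ {c = c} e))
    EntW-cut {nothing} {c = c} cX _ e = EntW-t⇒EntW {c = c} cX e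

    R⇒ConW : ∀ {i j X} → R i j → ConW i X → ConW j X
    R⇒ConW {just a}  {just b}  r cX = ConW-just⁺ (ax6 (ConW-just⁻ r) (ConW-just⁻ cX))
    R⇒ConW {just a}  {nothing} r _  = ⊥-elim (¬R-just-t r)
    R⇒ConW {nothing} {just b}  _ cX = ConW-just⁺ (ax2 (mapMaybe-id-⊆ (ConW-t⁻ cX)) (Con-[] b))
    R⇒ConW {nothing} {nothing} _ cX = cX

    R⇒EntW : ∀ {i j X c} → R i j → ConW i X → EntW i X c → EntW j X c
    R⇒EntW {just a}  {just b}  {c = c} r cX e =
      EntW-just⁺ {c = c} (R⇒ConW r cX)
        (Maybe.map (ax7 (ConW-just⁻ r) (ConW-just⁻ cX)) (EntW-just⁻ {c = c} e))
    R⇒EntW {just a}  {nothing}         r _  _ = ⊥-elim (¬R-just-t r)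
    R⇒EntW {nothing}           {c = c} r cX e = EntW-t⇒EntW {c = c} (R⇒ConW r cX) e

    EntL-interpolate : ∀ {i X Y} → EntL i X Y →
                       Σ (Maybe A) λ e → Σ (List (Maybe A)) λ Z →
                         ConW e Z × EntL i X (e ∷ Z) × EntL e Z Y
    EntL-interpolate {just a} {X} {Y} XY@(cX , _)
      with ax8 (ConW-just⁻ cX , EntL-just⁻ XY)
    ... | e , Z , cZ , (_ , Ee ∷ EZ) , (_ , ZY) =
      just e , map just Z , cZ′ ,
      EntL-just⁺ cX (Ee ∷ transport (All (Ent a (strip X))) EZ) ,
      EntL-just⁺ cZ′ (transport (λ Z′ → All (Ent e Z′) (strip Y)) ZY)
      where
      cZ′ : ConW (just e) (map just Z)
      cZ′ = ConW-map-just cZ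
      transport : (P : List A → Set ℓ) → P Z → P (strip (map just Z))
      transport P = subst P (sym (mapMaybe-id-map-just Z))
    EntL-interpolate {nothing} (cX , XY) =
      t , [] , c[] , (cX , ConW⇒EntW-t cX ∷ []) ,
      (c[] , All.map (λ {c} → EntW-t⇒EntW {c = c} c[]) XY)
      where
      c[] : ConW t []
      c[] = ConW-t⁺ (λ ())

    W-isCIF : IsCIF
    W-isCIF = record
      { ent-con = EntW⇒ConW
      ; ax1     = ConW-refl
      ; ax2     = ConW-⊆
      ; ax3     = ConW-EntL
      ; ax4     = EntW-weaken
      ; ax5     = EntW-cut
      ; ax6     = R⇒ConW
      ; ax7     = R⇒EntW
      ; ax8     = EntL-interpolate
      }

    t-isTruth : IsTruth t
    t-isTruth i = ConW⇒EntW-t (ConW-⊆ (λ ()) (ConW-refl i))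

theorem6p1 : ∀ {ℓ : Level} {A : Set ℓ}
               (Con : A → List A → Set ℓ) (Ent : A → List A → A → Set ℓ) →
               Frame.IsCIF Con Ent →
               Frame.IsCIF (W.ConW Con Ent) (W.EntW Con Ent)
                 × Frame.IsTruth (W.ConW Con Ent) (W.EntW Con Ent) (W.t Con Ent)
theorem6p1 Con Ent isCIF = W-isCIF Con Ent isCIF , t-isTruth Con Ent isCIF
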